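{- For any connected graph $G$ of order $n\geq 3$, $\gamma(C(G\circ P_1))=n$.
   Context: For a graph $G$ and $m\geq 1$, the $m$-corona $G\circ P_m$ is the graph of order $(m+1)|V(G)|$ obtained from $G$ by attaching to each vertex of $G$ a new path of order $m$ (for $m=1$: adding a new pendant vertex adjacent to each vertex of $G$). The central graph $C(H)$ of a simple graph $H$ is obtained from $H$ by subdividing each edge of $H$ exactly once and joining every pair of vertices non-adjacent in $H$ by an edge. $\gamma$ denotes the domination number. -}

module Defs where

open import Data.Nat using (ℕ; _≤_)
open import Data.Fin using (Fin; _<_; _≟_; _↑ˡ_; _↑ʳ_; splitAt)
open import Data.Bool using (Bool; true; false; not; _∧_; _∨_; T)
open import Data.Bool.Properties using (∧-zeroʳ)
open import Data.Sum using (_⊎_; inj₁; inj₂)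
open import Data.Product using (Σ; ∃; _×_; _,_; proj₁; proj₂)
open import Data.List using (List; length)
open import Data.List.Membership.Propositional using (_∈_)
open import Relation.Nullary using (yes; no; ¬_)
open import Relation.Nullary.Decidable using (⌊_⌋)
open import Relation.Binary.PropositionalEquality using (_≡_; refl; sym; cong)

-- A finite simple graph on vertex type V, with Bool-valued (hence decidable
-- and proof-irrelevant) adjacency, symmetric and loopless.
record Graph (V : Set) : Set where
  field
    adj        : V → V → Bool
    adj-sym    : ∀ u v → adj u v ≡ adj v u
    adj-irrefl : ∀ v → adj v v ≡ false
open Graph public

Adj : ∀ {V} → Graph V → V → V → Set
Adj G u v = T (adj G u v)

data Walk {V : Set} (G : Graph V) : V → V → Set where
  [] : ∀ {v} → Walk G v v
  _∷_ : ∀ {u v w} → Adj G u v → Walk G v w → Walk G u w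

Connected : ∀ {V} → Graph V → Set
Connected G = ∀ u v → Walk G u v

-- 1-corona G ∘ P₁ of a graph on Fin n: vertex set Fin (n + n);
-- i ↑ˡ n is the original vertex i, n ↑ʳ i is the new pendant vertex at i.

eqb : ∀ {n} → Fin n → Fin n → Bool
eqb a b = ⌊ a ≟ b ⌋

eqb-sym : ∀ {n} (a b : Fin n) → eqb a b ≡ eqb b a
eqb-sym a b with a ≟ b | b ≟ a
... | yes _ | yes _ = refl
... | no _  | no _  = refl
... | yes p | no q  = Data.Empty.⊥-elim (q (sym p)) where import Data.Empty
... | no p  | yes q = Data.Empty.⊥-elim (p (sym q)) where import Data.Empty

eqb-refl : ∀ {n} (a : Fin n) → eqb a a ≡ true
eqb-refl a with a ≟ a
... | yes _ = refl
... | no p = Data.Empty.⊥-elim (p refl) where import Data.Empty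

coronaAdj : ∀ {n} → Graph (Fin n) → Fin n ⊎ Fin n → Fin n ⊎ Fin n → Bool
coronaAdj G (inj₁ a) (inj₁ b) = adj G a b
coronaAdj G (inj₁ a) (inj₂ b) = eqb a b
coronaAdj G (inj₂ a) (inj₁ b) = eqb a b
coronaAdj G (inj₂ a) (inj₂ b) = false

corona : ∀ {n} → Graph (Fin n) → Graph (Fin (n Data.Nat.+ n))
corona {n} G = record
  { adj        = λ u v → coronaAdj G (splitAt n u) (splitAt n v)
  ; adj-sym    = λ u v → s (splitAt n u) (splitAt n v)
  ; adj-irrefl = λ v → r (splitAt n v)
  }
  where
  s : ∀ x y → coronaAdj G x y ≡ coronaAdj G y x
  s (inj₁ a) (inj₁ b) = adj-sym G a b
  s (inj₁ a) (inj₂ b) = eqb-sym a b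
  s (inj₂ a) (inj₁ b) = eqb-sym a b
  s (inj₂ a) (inj₂ b) = refl
  r : ∀ x → coronaAdj G x x ≡ false
  r (inj₁ a) = adj-irrefl G a
  r (inj₂ a) = refl

-- Central graph C(H) of a graph H on Fin m: vertices are the vertices of H
-- together with one new vertex for each edge {i,j} of H (represented once,
-- with i < j).

Edge : ∀ {m} → Graph (Fin m) → Set
Edge {m} H = Σ (Fin m × Fin m) λ p → (proj₁ p < proj₂ p) × Adj H (proj₁ p) (proj₂ p)

CVertex : ∀ {m} → Graph (Fin m) → Set
CVertex {m} H = Fin m ⊎ Edge H

incident : ∀ {m} {H : Graph (Fin m)} → Fin m → Edge H → Bool
incident w ((i , j) , _) = eqb w i ∨ eqb w j

centralAdj : ∀ {m} (H : Graph (Fin m)) → CVertex H → CVertex H → Bool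
centralAdj H (inj₁ u) (inj₁ v) = not (adj H u v) ∧ not (eqb u v)
centralAdj H (inj₁ w) (inj₂ e) = incident {H = H} w e
centralAdj H (inj₂ e) (inj₁ w) = incident {H = H} w e
centralAdj H (inj₂ _) (inj₂ _) = false

central : ∀ {m} → (H : Graph (Fin m)) → Graph (CVertex H)
central H = record
  { adj        = centralAdj H
  ; adj-sym    = s
  ; adj-irrefl = r
  }
  where
  s : ∀ x y → centralAdj H x y ≡ centralAdj H y x
  s (inj₁ u) (inj₁ v) rewrite adj-sym H u v | eqb-sym u v = refl
  s (inj₁ w) (inj₂ e) = refl
  s (inj₂ e) (inj₁ w) = refl
  s (inj₂ _) (inj₂ _) = refl
  r : ∀ x → centralAdj H x x ≡ false
  r (inj₁ u) rewrite eqb-refl u = ∧-zeroʳ (not (adj H u u))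
  r (inj₂ _) = refl

Dominating : ∀ {V} → Graph V → List V → Set
Dominating G D = ∀ v → v ∈ D ⊎ (Σ _ λ u → u ∈ D × Adj G u v)

IsDominationNumber : ∀ {V} → Graph V → ℕ → Set
IsDominationNumber G k =
  (Σ (List _) λ D → Dominating G D × length D ≡ k)
  × (∀ D → Dominating G D → k ≤ length D)

{-# OPTIONS --safe #-}
module Submission where

-- Every edge of G ∘ P₁ has an endpoint in G, and each pendant vertex of
-- G ∘ P₁ is non-adjacent to all but one vertex of G; so in the central graph
-- the n vertices of G dominate all subdivision and all pendant vertices.
-- Conversely, the subdivision vertex of the spoke {i, i'} at each vertex i of
-- G can only be dominated by itself, i or i', and these sets are disjoint for
-- distinct i, so every dominating set has at least n vertices.

open import Defs
open import Data.Nat using (ℕ; suc; _+_; _≤_; s≤s)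
open import Data.Nat.Properties using (≤-trans; m≤m+n)
open import Data.Fin using (Fin; toℕ; splitAt; _↑ˡ_; _↑ʳ_; punchIn)
import Data.Fin as Fin
open import Data.Fin.Properties
  using (toℕ-↑ˡ; toℕ-↑ʳ; toℕ<n; splitAt-↑ˡ; splitAt-↑ʳ; splitAt⁻¹-↑ˡ; splitAt⁻¹-↑ʳ;
         <⇒≢; injective⇒≤; punchInᵢ≢i)
open import Data.Bool using (false)
open import Data.Bool.Properties using (T-∨; T-∧; T-not-≡)
open import Data.Sum using (_⊎_; inj₁; inj₂; [_,_]′)
import Data.Sum as Sum
open import Data.Product using (∃; _×_; _,_; proj₁; proj₂)
open import Data.List using (List; length; map; allFin; lookup)
open import Data.List.Properties using (length-map; length-tabulate)
open import Data.List.Membership.Propositional using (_∈_)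
open import Data.List.Membership.Propositional.Properties using (∈-map⁺; ∈-allFin)
open import Data.List.Relation.Unary.Any using (index)
open import Data.List.Relation.Unary.Any.Properties using (lookup-index)
open import Function using (id; _∘_)
open import Function.Bundles using (Equivalence)
open import Relation.Nullary using (¬_)
open import Relation.Nullary.Decidable using (toWitness; fromWitness; fromWitnessFalse)
open import Relation.Binary.PropositionalEquality using (_≡_; _≢_; refl; sym; trans; cong)

open Equivalence using (to; from)

cover⇒≤length : ∀ {A : Set} {n} (f : A → Fin n) (D : List A) →
  (∀ i → ∃ λ x → x ∈ D × f x ≡ i) → n ≤ length D
cover⇒≤length f D cover = injective⇒≤ {f = position} position-injective
  where
  position : _ → Fin (length D)
  position i = index (proj₁ (proj₂ (cover i)))

  f-lookup-position : ∀ i → f (lookup D (position i)) ≡ i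
  f-lookup-position i with cover i
  ... | _ , x∈D , fx≡i = trans (cong f (sym (lookup-index x∈D))) fx≡i

  position-injective : ∀ {i j} → position i ≡ position j → i ≡ j
  position-injective {i} {j} eq =
    trans (sym (f-lookup-position i))
          (trans (cong (f ∘ lookup D) eq) (f-lookup-position j))

↑ˡ<↑ʳ : ∀ {m n} (i : Fin m) (j : Fin n) → i ↑ˡ n Fin.< m ↑ʳ j
↑ˡ<↑ʳ {m} {n} i j rewrite toℕ-↑ˡ i n | toℕ-↑ʳ m j = ≤-trans (toℕ<n i) (m≤m+n m (toℕ j))

↑ˡ-or-↑ʳ : ∀ m {n} (u : Fin (m + n)) → (∃ λ i → i ↑ˡ n ≡ u) ⊎ (∃ λ j → m ↑ʳ j ≡ u)
↑ˡ-or-↑ʳ m u with splitAt m u in eq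
... | inj₁ i = inj₁ (i , splitAt⁻¹-↑ˡ eq)
... | inj₂ j = inj₂ (j , splitAt⁻¹-↑ʳ eq)

∃≢ : ∀ {n} (j : Fin (suc (suc n))) → ∃ λ k → k ≢ j
∃≢ j = punchIn j Fin.zero , punchInᵢ≢i j Fin.zero

module _ {m} {H : Graph (Fin m)} where

  endpoints-adj-subdivision : ∀ (e : Edge H) →
    Adj (central H) (inj₁ (proj₁ (proj₁ e))) (inj₂ e) ×
    Adj (central H) (inj₁ (proj₂ (proj₁ e))) (inj₂ e)
  endpoints-adj-subdivision ((i , j) , _) =
    from (T-∨ {eqb i i}) (inj₁ (fromWitness refl)) ,
    from (T-∨ {eqb j i}) (inj₂ (fromWitness refl))

  adj-subdivision⇒endpoint : ∀ {w} (e : Edge H) → Adj (central H) (inj₁ w) (inj₂ e) →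
    w ≡ proj₁ (proj₁ e) ⊎ w ≡ proj₂ (proj₁ e)
  adj-subdivision⇒endpoint {w} ((i , j) , _) w~e =
    Sum.map toWitness toWitness (to (T-∨ {eqb w i}) w~e)

  nonadjacent⇒central-adj : ∀ {u v} → adj H u v ≡ false → u ≢ v →
    Adj (central H) (inj₁ u) (inj₁ v)
  nonadjacent⇒central-adj u≁v u≢v = from T-∧ (from T-not-≡ u≁v , fromWitnessFalse u≢v)

  dominated-subdivision : ∀ {D} → Dominating (central H) D → ∀ (e : Edge H) →
    inj₂ e ∈ D ⊎ inj₁ (proj₁ (proj₁ e)) ∈ D ⊎ inj₁ (proj₂ (proj₁ e)) ∈ D
  dominated-subdivision dom e with dom (inj₂ e)
  ... | inj₁ e∈D = inj₁ e∈D
  ... | inj₂ (inj₂ _ , _ , ())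
  ... | inj₂ (inj₁ w , w∈D , w~e) with adj-subdivision⇒endpoint {w} e w~e
  ...   | inj₁ refl = inj₂ (inj₁ w∈D)
  ...   | inj₂ refl = inj₂ (inj₂ w∈D)

  vertex-cover⇒dominating-central : (S : List (Fin m)) →
    (∀ (e : Edge H) → proj₁ (proj₁ e) ∈ S ⊎ proj₂ (proj₁ e) ∈ S) →
    (∀ v → v ∈ S ⊎ ∃ λ u → u ∈ S × adj H u v ≡ false × u ≢ v) →
    Dominating (central H) (map inj₁ S)
  vertex-cover⇒dominating-central S cover far (inj₁ v) with far v
  ... | inj₁ v∈S = inj₁ (∈-map⁺ inj₁ v∈S)
  ... | inj₂ (u , u∈S , u≁v , u≢v) =
    inj₂ (inj₁ u , ∈-map⁺ inj₁ u∈S , nonadjacent⇒central-adj u≁v u≢v)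
  vertex-cover⇒dominating-central S cover far (inj₂ e) with cover e
  ... | inj₁ i∈S = inj₂ (inj₁ _ , ∈-map⁺ inj₁ i∈S , proj₁ (endpoints-adj-subdivision e))
  ... | inj₂ j∈S = inj₂ (inj₁ _ , ∈-map⁺ inj₁ j∈S , proj₂ (endpoints-adj-subdivision e))

module Corona {n} (G : Graph (Fin n)) where

  originals : List (Fin (n + n))
  originals = map (_↑ˡ n) (allFin n)

  length-originals : length originals ≡ n
  length-originals = trans (length-map (_↑ˡ n) (allFin n)) (length-tabulate id)

  pendants-nonadjacent : ∀ a b → ¬ Adj (corona G) (n ↑ʳ a) (n ↑ʳ b)
  pendants-nonadjacent a b rewrite splitAt-↑ʳ n n a | splitAt-↑ʳ n n b = λ ()

  original-pendant-nonadjacent : ∀ {a b} → a ≢ b → adj (corona G) (a ↑ˡ n) (n ↑ʳ b) ≡ false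
  original-pendant-nonadjacent {a} {b} a≢b
    rewrite splitAt-↑ˡ n a n | splitAt-↑ʳ n n b = to T-not-≡ (fromWitnessFalse a≢b)

  spoke : Fin n → Edge (corona G)
  spoke i = (i ↑ˡ n , n ↑ʳ i) , ↑ˡ<↑ʳ i i , spoke-adj
    where
    spoke-adj : Adj (corona G) (i ↑ˡ n) (n ↑ʳ i)
    spoke-adj rewrite splitAt-↑ˡ n i n | splitAt-↑ʳ n n i = fromWitness refl

  originals-cover : ∀ (e : Edge (corona G)) →
    proj₁ (proj₁ e) ∈ originals ⊎ proj₂ (proj₁ e) ∈ originals
  originals-cover ((u , v) , _ , u~v) with ↑ˡ-or-↑ʳ n u | ↑ˡ-or-↑ʳ n v
  ... | inj₁ (a , refl) | _               = inj₁ (∈-map⁺ (_↑ˡ n) (∈-allFin a))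
  ... | inj₂ _          | inj₁ (b , refl) = inj₂ (∈-map⁺ (_↑ˡ n) (∈-allFin b))
  ... | inj₂ (a , refl) | inj₂ (b , refl) with () ← pendants-nonadjacent a b u~v

  base : Fin (n + n) → Fin n
  base u = [ id , id ]′ (splitAt n u)

  base-↑ˡ : ∀ i → base (i ↑ˡ n) ≡ i
  base-↑ˡ i rewrite splitAt-↑ˡ n i n = refl

  base-↑ʳ : ∀ i → base (n ↑ʳ i) ≡ i
  base-↑ʳ i rewrite splitAt-↑ʳ n n i = refl

  centralBase : CVertex (corona G) → Fin n
  centralBase (inj₁ u)            = base u
  centralBase (inj₂ ((u , _) , _)) = base u

  dominating⇒n≤length : ∀ D → Dominating (central (corona G)) D → n ≤ length D
  dominating⇒n≤length D dom = cover⇒≤length centralBase D covers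
    where
    covers : ∀ i → ∃ λ x → x ∈ D × centralBase x ≡ i
    covers i with dominated-subdivision dom (spoke i)
    ... | inj₁ s∈D        = _ , s∈D , base-↑ˡ i
    ... | inj₂ (inj₁ i∈D) = _ , i∈D , base-↑ˡ i
    ... | inj₂ (inj₂ i∈D) = _ , i∈D , base-↑ʳ i

γ-central-corona : ∀ {n} (G : Graph (Fin (suc (suc n)))) →
  IsDominationNumber (central (corona G)) (suc (suc n))
γ-central-corona {n} G =
  (map inj₁ originals , dominating , trans (length-map inj₁ originals) length-originals) ,
  dominating⇒n≤length
  where
  open Corona G

  far : ∀ v → v ∈ originals ⊎ ∃ λ u → u ∈ originals × adj (corona G) u v ≡ false × u ≢ v
  far v with ↑ˡ-or-↑ʳ (suc (suc n)) v
  ... | inj₁ (a , refl) = inj₁ (∈-map⁺ (_↑ˡ _) (∈-allFin a))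
  ... | inj₂ (j , refl) with ∃≢ j
  ...   | k , k≢j = inj₂ (k ↑ˡ _ , ∈-map⁺ (_↑ˡ _) (∈-allFin k) ,
                          original-pendant-nonadjacent k≢j , <⇒≢ (↑ˡ<↑ʳ k j))

  dominating : Dominating (central (corona G)) (map inj₁ originals)
  dominating = vertex-cover⇒dominating-central originals originals-cover far

theorem4p8 : (n : ℕ) (G : Graph (Fin n)) → 3 ≤ n → Connected G →
    IsDominationNumber (central (corona G)) n
theorem4p8 (suc (suc _)) G (s≤s (s≤s _)) _ = γ-central-corona G
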